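{- Let $j$ be an odd positive integer and let $(G_n)_{n\ge0}$ satisfy $G_n=G_{n-1}+G_{n-2}$ for $n\ge2$ with $G_0,G_1\in\mathbb{Z}$ relatively prime. Then the $j$-th Lucas number satisfies $L_j=\mathcal{G}_{G_0,G_1}(2j)$; more precisely, $$L_j=\gcd(G_{2j+1}-G_1,\;G_{2j+2}-G_2).$$
   Context: $L_n$ are the Lucas numbers ($L_0=2$, $L_1=1$, $L_n=L_{n-1}+L_{n-2}$). $\mathcal{G}_{G_0,G_1}(k)$ is the greatest common divisor of all integers $\sum_{i=0}^{k-1}G_{n+i}$, $n\ge1$. -}

module Defs where

open import Data.Nat using (ℕ; zero; suc; _≤_)
open import Data.Integer using (ℤ; +_; _+_; 0ℤ)
open import Data.Integer.Divisibility using (_∣_)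
open import Data.Product using (_×_)

lucas : ℕ → ℕ
lucas 0 = 2
lucas 1 = 1
lucas (suc (suc n)) = lucas (suc n) Data.Nat.+ lucas n

windowSum : (ℕ → ℤ) → ℕ → ℕ → ℤ
windowSum G zero    n = 0ℤ
windowSum G (suc k) n = G n + windowSum G k (suc n)

-- 𝒢_{G0,G1}(k) = d : d (≥ 0) is the greatest common divisor of all
-- integers windowSum G k n with n ≥ 1, i.e. d divides each of them and
-- every common divisor of them divides d.
IsWindowSumGCD : (ℕ → ℤ) → ℕ → ℕ → Set
IsWindowSumGCD G k d =
  (∀ n → 1 ≤ n → (+ d) ∣ windowSum G k n) ×
  (∀ c → (∀ n → 1 ≤ n → c ∣ windowSum G k n) → c ∣ (+ d))

-- For any sequence G with the Fibonacci recurrence, G (m + 2j) + (-1)^j G m = L_j G (m + j),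
-- by induction on j along L_{j+2} = L_{j+1} + L_j. A window sum of length k telescopes to
-- G (n + 1 + k) - G (n + 1), so for odd j every window sum of length 2j is L_j times a term
-- of G. Consecutive terms of G remain coprime, because a common divisor of two of them
-- descends through the recurrence to G 0 and G 1; hence the gcd of L_j times two consecutive
-- terms is L_j, which yields both the gcd of the window sums and the explicit formula.
module Submission where

open import Defs
open import Data.Nat using (ℕ; zero; suc; _%_; _≤_; s≤s; z≤n) renaming (_*_ to _*ℕ_; _+_ to _+ℕ_)
import Data.Nat.Properties as ℕ
import Data.Nat.GCD as ℕ
import Data.Nat.Coprimality as ℕ
import Data.Nat.Tactic.RingSolver as ℕ-Ring
open import Data.Integer using (ℤ; +_; _+_; _-_; _*_; -_; _^_; ∣_∣; 1ℤ; -1ℤ)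
open import Data.Integer.Properties
  using (abs-*; pos-+; neg-involutive; -1*i≡-i; +-inverseʳ; *-distribʳ-+)
open import Data.Integer.Coprimality using (Coprime)
open import Data.Integer.Divisibility using (_∣_)
import Data.Integer.Divisibility.Signed as Signed
open import Data.Integer.GCD using (gcd; gcd-greatest)
import Data.Integer.Tactic.RingSolver as ℤ-Ring
open import Data.List using ([]; _∷_)
open import Data.Product using (_×_; _,_)
open import Relation.Binary.PropositionalEquality
  using (_≡_; refl; sym; trans; cong; cong₂; subst; module ≡-Reasoning)

IsFibonacciLike : (ℕ → ℤ) → Set
IsFibonacciLike G = ∀ n → G (suc (suc n)) ≡ G (suc n) + G n

-1^odd≡-1 : ∀ j → j % 2 ≡ 1 → -1ℤ ^ j ≡ -1ℤ
-1^odd≡-1 (suc zero)    _   = refl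
-1^odd≡-1 (suc (suc j)) odd = begin
  -1ℤ * (-1ℤ * -1ℤ ^ j) ≡⟨ trans (-1*i≡-i _) (cong -_ (-1*i≡-i _)) ⟩
  - - (-1ℤ ^ j)         ≡⟨ neg-involutive _ ⟩
  -1ℤ ^ j               ≡⟨ -1^odd≡-1 j odd ⟩
  -1ℤ                   ∎
  where open ≡-Reasoning

gcd-*-coprime : ∀ a x y → Coprime x y → gcd (+ a * x) (+ a * y) ≡ + a
gcd-*-coprime a x y cop = cong +_ (begin
  ℕ.gcd (∣ + a * x ∣) (∣ + a * y ∣) ≡⟨ cong₂ ℕ.gcd (abs-* (+ a) x) (abs-* (+ a) y) ⟩
  ℕ.gcd (a *ℕ ∣ x ∣) (a *ℕ ∣ y ∣)   ≡⟨ sym (ℕ.c*gcd[m,n]≡gcd[cm,cn] a (∣ x ∣) (∣ y ∣)) ⟩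
  a *ℕ ℕ.gcd (∣ x ∣) (∣ y ∣)        ≡⟨ cong (a *ℕ_) (ℕ.coprime⇒gcd≡1 cop) ⟩
  a *ℕ 1                            ≡⟨ ℕ.*-identityʳ a ⟩
  a                                 ∎)
  where open ≡-Reasoning

coprime-factors : ∀ {c} a x y → Coprime x y → (c ∣ + a * x) × (c ∣ + a * y) → c ∣ + a
coprime-factors {c} a x y cop (c∣ax , c∣ay) =
  subst (c ∣_) (gcd-*-coprime a x y cop) (gcd-greatest {+ a * x} {+ a * y} {c} c∣ax c∣ay)

module FibonacciLike (G : ℕ → ℤ) (rec : IsFibonacciLike G) where

  windowSum-telescopes : ∀ k n → windowSum G k n ≡ G (k +ℕ suc n) - G (suc n)
  windowSum-telescopes zero    n = sym (+-inverseʳ (G (suc n)))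
  windowSum-telescopes (suc k) n = begin
    G n + windowSum G k (suc n)
      ≡⟨ cong (λ x → G n + x) (windowSum-telescopes k (suc n)) ⟩
    G n + (G (k +ℕ suc (suc n)) - G (suc (suc n)))
      ≡⟨ cong (λ x → G n + (G (k +ℕ suc (suc n)) - x)) (rec n) ⟩
    G n + (G (k +ℕ suc (suc n)) - (G (suc n) + G n))
      ≡⟨ regroup (G n) (G (k +ℕ suc (suc n))) (G (suc n)) ⟩
    G (k +ℕ suc (suc n)) - G (suc n)
      ≡⟨ cong (λ i → G i - G (suc n)) (ℕ.+-suc k (suc n)) ⟩
    G (suc k +ℕ suc n) - G (suc n) ∎
    where
    open ≡-Reasoning
    regroup : ∀ x y z → x + (y - (z + x)) ≡ y - z
    regroup = ℤ-Ring.solve-∀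

  lucas-shift : ∀ j m → G (2 *ℕ j +ℕ m) + -1ℤ ^ j * G m ≡ + lucas j * G (j +ℕ m)
  lucas-shift zero          m = double (G m)
    where
    double : ∀ x → x + 1ℤ * x ≡ + 2 * x
    double = ℤ-Ring.solve-∀
  lucas-shift (suc zero)    m = trans (cong (_+ -1ℤ * 1ℤ * G m) (rec m)) (cancel (G (suc m)) (G m))
    where
    cancel : ∀ y x → y + x + -1ℤ * 1ℤ * x ≡ + 1 * y
    cancel = ℤ-Ring.solve-∀
  lucas-shift (suc (suc j)) m = begin
    G (2 *ℕ (2 +ℕ j) +ℕ m) + -1ℤ * (-1ℤ * s) * G m
      ≡⟨ cong (_+ -1ℤ * (-1ℤ * s) * G m) (trans (cong G (index 2 0)) (rec _)) ⟩
    G (3 +ℕ (2 *ℕ j +ℕ m)) + G (2 +ℕ (2 *ℕ j +ℕ m)) + -1ℤ * (-1ℤ * s) * G m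
      ≡⟨ regroup (G (3 +ℕ (2 *ℕ j +ℕ m))) _ _ _ s ⟩
    (G (3 +ℕ (2 *ℕ j +ℕ m)) + -1ℤ * s * G (suc m)) + (G (2 +ℕ (2 *ℕ j +ℕ m)) + s * (G (suc m) + G m))
      ≡⟨ cong₂ _+_ (cong (_+ -1ℤ * s * G (suc m)) (cong G (sym (index 1 1))))
                   (cong₂ _+_ (cong G (sym (index 0 2))) (cong (λ x → s * x) (sym (rec m)))) ⟩
    (G (2 *ℕ suc j +ℕ suc m) + -1ℤ ^ suc j * G (suc m)) + (G (2 *ℕ j +ℕ suc (suc m)) + s * G (suc (suc m)))
      ≡⟨ cong₂ _+_ (lucas-shift (suc j) (suc m)) (lucas-shift j (suc (suc m))) ⟩
    + lucas (suc j) * G (suc j +ℕ suc m) + + lucas j * G (j +ℕ suc (suc m))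
      ≡⟨ cong₂ (λ a b → + lucas (suc j) * G a + + lucas j * G b)
               (ℕ.+-suc (suc j) m) (trans (ℕ.+-suc j (suc m)) (cong suc (ℕ.+-suc j m))) ⟩
    + lucas (suc j) * G (suc (suc j) +ℕ m) + + lucas j * G (suc (suc j) +ℕ m)
      ≡⟨ sym (*-distribʳ-+ _ (+ lucas (suc j)) (+ lucas j)) ⟩
    (+ lucas (suc j) + + lucas j) * G (suc (suc j) +ℕ m)
      ≡⟨ cong (_* G (suc (suc j) +ℕ m)) (sym (pos-+ (lucas (suc j)) (lucas j))) ⟩
    + lucas (suc (suc j)) * G (suc (suc j) +ℕ m) ∎
    where
    open ≡-Reasoning
    s : ℤ
    s = -1ℤ ^ j
    index : ∀ a b → 2 *ℕ (a +ℕ j) +ℕ (b +ℕ m) ≡ (2 *ℕ a +ℕ b) +ℕ (2 *ℕ j +ℕ m)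
    index a b = ℕ-Ring.solve (a ∷ b ∷ j ∷ m ∷ [])
    regroup : ∀ a b c d s → a + b + -1ℤ * (-1ℤ * s) * d ≡ (a + -1ℤ * s * c) + (b + s * (c + d))
    regroup = ℤ-Ring.solve-∀

  lucas-shift-odd : ∀ j → j % 2 ≡ 1 → ∀ m → G (2 *ℕ j +ℕ m) - G m ≡ + lucas j * G (m +ℕ j)
  lucas-shift-odd j odd m = begin
    G (2 *ℕ j +ℕ m) - G m
      ≡⟨ cong (λ x → G (2 *ℕ j +ℕ m) + x) (sym (-1*i≡-i (G m))) ⟩
    G (2 *ℕ j +ℕ m) + -1ℤ * G m
      ≡⟨ cong (λ s → G (2 *ℕ j +ℕ m) + s * G m) (sym (-1^odd≡-1 j odd)) ⟩
    G (2 *ℕ j +ℕ m) + -1ℤ ^ j * G m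
      ≡⟨ lucas-shift j m ⟩
    + lucas j * G (j +ℕ m)
      ≡⟨ cong (λ i → + lucas j * G i) (ℕ.+-comm j m) ⟩
    + lucas j * G (m +ℕ j) ∎
    where open ≡-Reasoning

  windowSum-lucas : ∀ j → j % 2 ≡ 1 → ∀ n → windowSum G (2 *ℕ j) n ≡ + lucas j * G (suc n +ℕ j)
  windowSum-lucas j odd n = trans (windowSum-telescopes (2 *ℕ j) n) (lucas-shift-odd j odd (suc n))

  common-divisor-descends : ∀ {c} m → c Signed.∣ G m → c Signed.∣ G (suc m) →
                            c Signed.∣ G 0 × c Signed.∣ G 1
  common-divisor-descends zero    c∣G₀ c∣G₁ = c∣G₀ , c∣G₁
  common-divisor-descends {c} (suc m) c∣Gₘ₊₁ c∣Gₘ₊₂ =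
    common-divisor-descends m c∣Gₘ c∣Gₘ₊₁
    where
    c∣Gₘ : c Signed.∣ G m
    c∣Gₘ = Signed.∣m+n∣m⇒∣n (subst (c Signed.∣_) (rec m) c∣Gₘ₊₂) c∣Gₘ₊₁

  consecutive-coprime : Coprime (G 0) (G 1) → ∀ m → Coprime (G m) (G (suc m))
  consecutive-coprime cop m {d} (d∣Gₘ , d∣Gₘ₊₁)
    with common-divisor-descends {+ d} m (Signed.∣ᵤ⇒∣ d∣Gₘ) (Signed.∣ᵤ⇒∣ d∣Gₘ₊₁)
  ... | d∣G₀ , d∣G₁ = cop (Signed.∣⇒∣ᵤ d∣G₀ , Signed.∣⇒∣ᵤ d∣G₁)

theorem6p10 : (j : ℕ) → j % 2 ≡ 1 →
    (G : ℕ → ℤ) → (∀ n → G (suc (suc n)) ≡ G (suc n) + G n) →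
    Coprime (G 0) (G 1) →
    IsWindowSumGCD G (2 *ℕ j) (lucas j) ×
    (+ lucas j ≡ gcd (G (2 *ℕ j +ℕ 1) - G 1) (G (2 *ℕ j +ℕ 2) - G 2))
theorem6p10 j odd G rec cop = (lucas∣windowSums , windowSum-divisor∣lucas) , gcd-formula
  where
  open FibonacciLike G rec
  lucas∣windowSums : ∀ n → 1 ≤ n → + lucas j ∣ windowSum G (2 *ℕ j) n
  lucas∣windowSums n _ =
    subst (+ lucas j ∣_) (sym (windowSum-lucas j odd n))
      (Signed.∣⇒∣ᵤ (Signed.∣m⇒∣m*n (G (suc n +ℕ j)) (Signed.∣-refl {+ lucas j})))
  windowSum-divisor∣lucas : ∀ c → (∀ n → 1 ≤ n → c ∣ windowSum G (2 *ℕ j) n) → c ∣ + lucas j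
  windowSum-divisor∣lucas c c∣windowSums =
    coprime-factors {c} (lucas j) (G (2 +ℕ j)) (G (3 +ℕ j)) (consecutive-coprime cop (2 +ℕ j))
      (subst (c ∣_) (windowSum-lucas j odd 1) (c∣windowSums 1 (s≤s z≤n)) ,
       subst (c ∣_) (windowSum-lucas j odd 2) (c∣windowSums 2 (s≤s z≤n)))
  gcd-formula : + lucas j ≡ gcd (G (2 *ℕ j +ℕ 1) - G 1) (G (2 *ℕ j +ℕ 2) - G 2)
  gcd-formula = sym (trans (cong₂ gcd (lucas-shift-odd j odd 1) (lucas-shift-odd j odd 2))
                           (gcd-*-coprime (lucas j) (G (1 +ℕ j)) (G (2 +ℕ j))
                                          (consecutive-coprime cop (1 +ℕ j))))
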